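{- For all positive integers $s$ and $t$, \[ 1<\frac{K'(s,t)}{K(s,t)}<1+2^{3-s}. \]
   Context: For positive integers $s,t$: $K(1,t)=2$, $K'(1,t)=5$ for all $t$; $K(s,1)=2^s$, $K'(s,1)=2^s+3$ for all $s$; and for $s,t>1$, $K(s,t)=K(s,t-1)\,K(s-1,K'(s,t-1))$ and $K'(s,t)=K'(s,t-1)\,K(s-1,K'(s,t-1))+K'(s-1,K'(s,t-1))$. -}

module Defs where

open import Data.Nat using (ℕ; zero; suc; _+_; _*_; _^_)
open import Data.Product using (_×_; _,_; proj₁; proj₂)

-- Values at s = 0 or t = 0 are junk (never used by the statement).
private
  step : (ℕ → ℕ × ℕ) → ℕ → ℕ → ℕ × ℕ
  step prev s zero = (0 , 0)
  step prev s (suc zero) = (2 ^ s , 2 ^ s + 3)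
  step prev s (suc (suc t)) with step prev s (suc t)
  ... | (k , k') = (k * proj₁ (prev k') , k' * proj₁ (prev k') + proj₂ (prev k'))

KK : ℕ → ℕ → ℕ × ℕ
KK zero t = (0 , 0)
KK (suc zero) zero = (0 , 0)
KK (suc zero) (suc t) = (2 , 5)
KK (suc (suc s)) t = step (KK (suc s)) (suc (suc s)) t

K : ℕ → ℕ → ℕ
K s t = proj₁ (KK s t)

K′ : ℕ → ℕ → ℕ
K′ s t = proj₂ (KK s t)

{-# OPTIONS --safe #-}
-- Write (k, k′) = (K, K′)(s, t) and (a, b) = (K, K′)(s - 1, k′), so that
-- (K, K′)(s, t + 1) = (k a, k′ a + b). If b + c ≤ c a, then k′ + c grows by a
-- factor of at most a per step, so a bound 2^s (K′ + c) ≤ (2^s + 8) K with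
-- slack c propagates in t from t = 1. Level 1, where (a, b) = (2, 5), absorbs
-- c = 5; a level s ≥ 2 satisfying the bound with c ≥ 4 has b + 4 ≤ 4 a, so it
-- absorbs c = 4 for the next level. Hence levels 1 and 2 satisfy the bound with
-- c = 5 and all higher levels with c = 4, and any positive slack gives the
-- strict upper bound. The lower bound K < K′ follows from b > 0.
module Submission where

open import Defs
open import Data.Nat using (ℕ; zero; suc; _+_; _*_; _^_; _<_; _≤_; z<s; >-nonZero)
open import Data.Nat.Properties
open import Data.Nat.Tactic.RingSolver using (solve-∀)
open import Data.Product using (_×_; _,_)
open import Relation.Binary.PropositionalEquality using (_≡_; cong)

k<k′⇒k*a<k′*a+b : ∀ {k k′ a b} → k < k′ → 0 < b → k * a < k′ * a + b
k<k′⇒k*a<k′*a+b {a = a} {b} k<k′ 0<b =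
  ≤-<-trans (*-monoˡ-≤ a (<⇒≤ k<k′)) (m<m+n _ 0<b)

K<K′ : ∀ s t → 1 ≤ t → K (suc s) t < K′ (suc s) t
K<K′ zero (suc t) _ = m<m+n 2 z<s
K<K′ (suc s) (suc zero) _ = m<m+n (2 ^ (2 + s)) z<s
K<K′ (suc s) (suc (suc t)) _ =
  let k<k′ = K<K′ (suc s) (suc t) z<s
  in k<k′⇒k*a<k′*a+b k<k′ (m<n⇒0<n (K<K′ s _ (m<n⇒0<n k<k′)))

SlackBound : ℕ → ℕ → Set
SlackBound c s = ∀ t → 1 ≤ t → 2 ^ s * (K′ s t + c) ≤ (2 ^ s + 8) * K s t

SlackAbsorbing : ℕ → ℕ → Set
SlackAbsorbing c s = ∀ t → 1 ≤ t → K′ s t + c ≤ c * K s t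

slack-step : ∀ P Q {c k k′ a b} → P * (k′ + c) ≤ Q * k → b + c ≤ c * a →
             P * (k′ * a + b + c) ≤ Q * (k * a)
slack-step P Q {c} {k} {k′} {a} {b} bound absorb = begin
  P * (k′ * a + b + c)   ≡⟨ cong (P *_) (+-assoc (k′ * a) b c) ⟩
  P * (k′ * a + (b + c)) ≤⟨ *-monoʳ-≤ P (+-monoʳ-≤ (k′ * a) absorb) ⟩
  P * (k′ * a + c * a)   ≡⟨ factor P k′ c a ⟩
  P * (k′ + c) * a       ≤⟨ *-monoˡ-≤ a bound ⟩
  Q * k * a              ≡⟨ *-assoc Q k a ⟩
  Q * (k * a)            ∎
  where
    open ≤-Reasoning
    factor : ∀ P k′ c a → P * (k′ * a + c * a) ≡ P * (k′ + c) * a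
    factor = solve-∀

slackBound-induction : ∀ {c} s → SlackAbsorbing c (suc s) →
  2 ^ (2 + s) * (K′ (2 + s) 1 + c) ≤ (2 ^ (2 + s) + 8) * K (2 + s) 1 →
  SlackBound c (2 + s)
slackBound-induction s absorbing base (suc zero) _ = base
slackBound-induction {c} s absorbing base (suc (suc t)) _ =
  let k′ = K′ (2 + s) (1 + t)
  in slack-step (2 ^ (2 + s)) (2 ^ (2 + s) + 8)
       {c} {K (2 + s) (1 + t)} {k′} {K (1 + s) k′} {K′ (1 + s) k′}
       (slackBound-induction s absorbing base (suc t) z<s)
       (absorbing k′ (m<n⇒0<n (K<K′ (suc s) (suc t) z<s)))

4≤slack⇒b+4≤4*a : ∀ P {a b c} → 4 ≤ P → 4 ≤ c → P * (b + c) ≤ (P + 8) * a → b + 4 ≤ 4 * a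
4≤slack⇒b+4≤4*a P {a} {b} {c} 4≤P 4≤c bound = *-cancelˡ-≤ P {{>-nonZero (≤-trans z<s 4≤P)}} (begin
  P * (b + 4)   ≤⟨ *-monoʳ-≤ P (+-monoʳ-≤ b 4≤c) ⟩
  P * (b + c)   ≤⟨ bound ⟩
  (P + 8) * a   ≤⟨ *-monoˡ-≤ a (+-monoʳ-≤ P (≤-trans (m≤m+n 8 4) (*-monoʳ-≤ 3 4≤P))) ⟩
  4 * P * a     ≡⟨ swap P a ⟩
  P * (4 * a)   ∎)
  where
    open ≤-Reasoning
    swap : ∀ P a → 4 * P * a ≡ P * (4 * a)
    swap = solve-∀

slackBound⇒slackAbsorbing : ∀ c s → 4 ≤ c → SlackBound c (2 + s) → SlackAbsorbing 4 (2 + s)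
slackBound⇒slackAbsorbing c s 4≤c bound t 1≤t =
  4≤slack⇒b+4≤4*a (2 ^ (2 + s)) (^-monoʳ-≤ 2 (m≤m+n 2 s)) 4≤c (bound t 1≤t)

slackBound-base : ∀ P → P * (P + 3 + 4) ≤ (P + 8) * P
slackBound-base P = ≤-trans (m≤m+n (P * (P + 3 + 4)) P) (≤-reflexive (expand P))
  where
    expand : ∀ P → P * (P + 3 + 4) + P ≡ (P + 8) * P
    expand = solve-∀

slackBound₁ : SlackBound 5 1
slackBound₁ (suc t) _ = ≤-refl

slackBound₂ : SlackBound 5 2
slackBound₂ = slackBound-induction 0 absorbing₁ ≤-refl -- 4 * (7 + 5) = 12 * 4
  where
    absorbing₁ : SlackAbsorbing 5 1
    absorbing₁ (suc t) _ = ≤-refl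

slackBound₃₊ : ∀ s → SlackBound 4 (3 + s)
slackAbsorbing₂₊ : ∀ s → SlackAbsorbing 4 (2 + s)

slackBound₃₊ s = slackBound-induction (suc s) (slackAbsorbing₂₊ s) (slackBound-base (2 ^ (3 + s)))

slackAbsorbing₂₊ zero = slackBound⇒slackAbsorbing 5 0 (m≤m+n 4 1) slackBound₂
slackAbsorbing₂₊ (suc s) = slackBound⇒slackAbsorbing 4 (suc s) ≤-refl (slackBound₃₊ s)

slackBound⇒upperBound : ∀ c s → 1 ≤ c → SlackBound c s →
  ∀ t → 1 ≤ t → 2 ^ s * K′ s t < (2 ^ s + 8) * K s t
slackBound⇒upperBound c s 1≤c bound t 1≤t =
  <-≤-trans (*-monoʳ-< (2 ^ s) {{m^n≢0 2 s}} (m<m+n (K′ s t) 1≤c)) (bound t 1≤t)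

upperBound : ∀ s t → 1 ≤ t → 2 ^ suc s * K′ (suc s) t < (2 ^ suc s + 8) * K (suc s) t
upperBound zero = slackBound⇒upperBound 5 1 z<s slackBound₁
upperBound (suc zero) = slackBound⇒upperBound 5 2 z<s slackBound₂
upperBound (suc (suc s)) = slackBound⇒upperBound 4 (3 + s) z<s (slackBound₃₊ s)

mainTheorem7 : (s t : ℕ) → 1 ≤ s → 1 ≤ t →
    (K s t < K′ s t) × (2 ^ s * K′ s t < (2 ^ s + 8) * K s t)
mainTheorem7 (suc s) t _ 1≤t = K<K′ s t 1≤t , upperBound s t 1≤t
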